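{- Let $n>4$ and let $P$ be a pot such that $C_{min}(P)=\{W_n\}$. Then in any realization of $W_n$ by $P$, each bond-edge type is used on at most two edges of the outer cycle.
   Context: The wheel graph $W_n$ consists of a cycle on $n-1$ vertices (the outer cycle) together with one additional vertex (the hub) adjacent to every vertex of the cycle; the edges from the hub are called spokes. A tile is a vertex together with a finite multiset of half-edges, each half-edge labeled by a cohesive-end symbol $a$ or its complement $\hat a$, where $a$ ranges over an alphabet of bond-edge types. A pot $P$ is a finite set of distinct tile types. A graph $G$ (loops and multiple edges allowed) is realized by $P$ if each vertex of $G$ can be assigned a copy of some tile type in $P$ (any number of copies of each type may be used) so that the half-edges at each vertex are in bijection with the edge-ends at that vertex and every edge of $G$ is formed by joining a half-edge labeled $a$ with a half-edge labeled $\hat a$ for some bond-edge type $a$ (the edge is then said to use bond-edge type $a$), with no half-edge left unmatched. $C_{min}(P)$ is the set of graphs of minimum order among all graphs realized by $P$; the hypothesis $C_{min}(P)=\{W_n\}$ means (up to isomorphism) $W_n$ is the unique graph of minimum order realized by $P$. -}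

module Defs where

open import Data.Nat using (ℕ; zero; suc; _+_; _≤_; _<_) renaming (_≟_ to _≟ℕ_)
open import Data.Nat.DivMod using (_%_; m%n<n)
open import Data.Bool using (Bool; true; false; not)
open import Data.Fin using (Fin; toℕ; fromℕ<; splitAt; _↑ˡ_) renaming (zero to fzero; suc to fsuc)
open import Data.Sum using (_⊎_; inj₁; inj₂)
open import Data.Product using (_×_; _,_; proj₁; proj₂; Σ; ∃)
open import Data.List using (List; []; _∷_; _++_; concatMap; length; lookup; filter; allFin)
open import Data.List.Relation.Binary.Permutation.Propositional using (_↭_)
open import Data.Fin using () renaming (_≟_ to _≟F_)
open import Function.Bundles using (_↔_; Inverse)
open import Relation.Binary.PropositionalEquality using (_≡_)
open import Relation.Nullary using (does)

-- Bond-edge types are natural numbers. A cohesive end is a bond-edge type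
-- together with a flag: false = the symbol a, true = its complement â.
CEnd : Set
CEnd = ℕ × Bool

-- A tile type: the finite multiset of its half-edge labels, represented by a
-- list (taken up to permutation, see `Realization.fits`).
Tile : Set
Tile = List CEnd

Pot : Set
Pot = List Tile

Graph : ℕ → ℕ → Set
Graph V E = Fin E → Fin V × Fin V

-- Labels of the edge-ends at vertex v, given for each edge its bond-edge type
-- and whether its first end carries the complemented symbol (the second end
-- then carries the other one).
endLabels : ∀ {V E} → Graph V E → (Fin E → ℕ) → (Fin E → Bool) → Fin V → List CEnd
endLabels {E = E} G bond hat v = concatMap labs (allFin E)
  where
  labs : Fin E → List CEnd
  labs e = firstEnd ++ secondEnd
    where
    firstEnd : List CEnd
    firstEnd with does (proj₁ (G e) ≟F v)
    ... | true  = (bond e , hat e) ∷ []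
    ... | false = []
    secondEnd : List CEnd
    secondEnd with does (proj₂ (G e) ≟F v)
    ... | true  = (bond e , not (hat e)) ∷ []
    ... | false = []

record Realization (P : Pot) {V E : ℕ} (G : Graph V E) : Set where
  field
    tile : Fin V → Fin (length P)
    bond : Fin E → ℕ
    hat  : Fin E → Bool
    fits : ∀ v → endLabels G bond hat v ↭ lookup P (tile v)

record Iso {V E V' E'} (G : Graph V E) (G' : Graph V' E') : Set where
  field
    vmap : Fin V ↔ Fin V'
    emap : Fin E ↔ Fin E'
    preserves : ∀ e →
      let φ = Inverse.to vmap in
      (G' (Inverse.to emap e) ≡ (φ (proj₁ (G e)) , φ (proj₂ (G e))))
      ⊎ (G' (Inverse.to emap e) ≡ (φ (proj₂ (G e)) , φ (proj₁ (G e))))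

cyc : ∀ {k} → Fin k → Fin k
cyc {suc j} i = fromℕ< (m%n<n (suc (toℕ i)) (suc j))

-- The wheel W_{k+1}: hub = vertex zero, outer cycle on vertices suc i (i : Fin k).
-- Edges i ↑ˡ k (i : Fin k) are the outer-cycle edges {suc i, suc (cyc i)};
-- edges k ↑ʳ i are the spokes {hub, suc i}.
wheel : (k : ℕ) → Graph (suc k) (k + k)
wheel k e with splitAt k e
... | inj₁ i = (fsuc i , fsuc (cyc i))
... | inj₂ i = (fzero , fsuc i)

-- C_min(P) = {W_{k+1}}: W_{k+1} is realized by P, every nonempty graph realized
-- by P has order ≥ k+1, and every graph of order k+1 realized by P is
-- isomorphic to W_{k+1}.
record CminIsWheel (P : Pot) (k : ℕ) : Set where
  field
    wheelRealized : Realization P (wheel k)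
    minimal : ∀ V E (G : Graph V E) → 0 < V → Realization P G → suc k ≤ V
    unique  : ∀ E (G : Graph (suc k) E) → Realization P G → Iso G (wheel k)

cycleUses : ∀ {P k} → Realization P (wheel k) → ℕ → ℕ
cycleUses {k = k} r a =
  length (filter (λ i → Realization.bond r (i ↑ˡ k) ≟ℕ a) (allFin k))

-- Suppose two outer-cycle edges {u, u⁺} and {w, w⁺} of a realization of W_n
-- carry the same bond-edge type with the same orientation. Exchanging their
-- second ends, i.e. replacing them by {u, w⁺} and {w, u⁺}, leaves the multiset
-- of half-edge labels at every vertex unchanged, so the same tiles realize the
-- new graph. It has the order of W_n, hence is isomorphic to W_n; but deleting
-- its hub disconnects the arcs u⁺ … w and w⁺ … u of the old cycle, whereas W_n
-- has no cut vertex. So a bond-edge type occurs on at most one cycle edge in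
-- each orientation, that is, on at most two.
module Submission where

open import Defs
open import Data.Bool using (Bool; true; false; not; _∧_; if_then_else_)
open import Data.Bool.Properties using (∧-zeroʳ; ¬-not) renaming (_≟_ to _≟ᴮ_)
open import Data.Fin using (Fin; toℕ; inject₁; join; splitAt; _↑ˡ_; _↑ʳ_)
  renaming (zero to fzero; suc to fsuc)
open import Data.Fin.Induction using (<-weakInduction)
open import Data.Fin.Permutation.Components using (transpose)
open import Data.Fin.Properties
  using ( _≟_; toℕ-injective; toℕ<n; toℕ-inject₁; toℕ-fromℕ<; ↑ˡ-injective
        ; splitAt-↑ˡ; splitAt-↑ʳ; join-splitAt)
  renaming (<-cmp to <ᶠ-cmp)
open import Data.List using (List; []; _∷_; _++_; [_]; concatMap; allFin; map; filter; length; lookup)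
open import Data.List.Membership.Propositional using (_∈_)
open import Data.List.Membership.Propositional.Properties using (∈-allFin; ∈-map⁺; ∈-filter⁻)
open import Data.List.Membership.Propositional.Properties.WithK using (unique∧set⇒bag)
open import Data.List.Properties using (concatMap-cong; concatMap-map)
open import Data.List.Relation.Binary.BagAndSetEquality
  using (bag; _∼[_]_; >>=-cong; >>=-left-distributive; ∼bag⇒↭)
open import Data.List.Relation.Binary.Permutation.Propositional
  using (_↭_; module PermutationReasoning)
open import Data.List.Relation.Binary.Permutation.Propositional.Properties using (++⁺ˡ)
open import Data.List.Relation.Unary.AllPairs using (_∷_)
open import Data.List.Relation.Unary.All using (_∷_)
open import Data.List.Relation.Unary.Any using (here; there)
open import Data.List.Relation.Unary.Unique.Propositional using (Unique)
open import Data.List.Relation.Unary.Unique.Propositional.Properties using (allFin⁺; map⁺; filter⁺)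
open import Data.Nat using (ℕ; suc; _+_; _<_; _≤_; _<?_; _≤?_; z≤n; s≤s)
  renaming (_≟_ to _≟ℕ_)
open import Data.Nat.DivMod using (_%_; m<n⇒m%n≡m; n%n≡0)
open import Data.Nat.Properties
  using ( <-cmp; <-trans; ≤-<-trans; ≤-refl; ≤⇒≯; <⇒≱; <⇒≤; ≤∧≢⇒<; ≮⇒≥; n<1+n
        ; m<1+n⇒m≤n; m≤n⇒m<n∨m≡n)
open import Data.Product using (Σ; _×_; _,_; proj₁; proj₂; ∃₂)
open import Data.Sum using (inj₁; inj₂)
open import Function using (_∘_; Inverse; mk⇔)
open import Function.Related.Propositional using (K-refl)
open import Relation.Binary using (tri<; tri≈; tri>)
open import Relation.Binary.PropositionalEquality
  using (_≡_; _≢_; refl; sym; trans; cong; cong₂; subst; module ≡-Reasoning)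
open import Relation.Nullary using (Dec; does; yes; no; ¬_; contradiction)
open import Relation.Nullary.Decidable using (dec-true; dec-false)

transpose-atˡ : ∀ {n} (p q : Fin n) → transpose p q p ≡ q
transpose-atˡ p q rewrite dec-true (p ≟ p) refl = refl

transpose-atʳ : ∀ {n} (p q : Fin n) → transpose p q q ≡ p
transpose-atʳ p q with q ≟ p
... | yes q≡p = q≡p
... | no _ rewrite dec-true (q ≟ q) refl = refl

transpose-elsewhere : ∀ {n} {p q k : Fin n} → k ≢ p → k ≢ q → transpose p q k ≡ k
transpose-elsewhere {p = p} {q} {k} k≢p k≢q rewrite dec-false (k ≟ p) k≢p | dec-false (k ≟ q) k≢q = refl

transpose-invariant : ∀ {n} {A : Set} (f : Fin n → A) {p q : Fin n} → f p ≡ f q →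
  ∀ k → f (transpose p q k) ≡ f k
transpose-invariant f {p} {q} fp≡fq k with k ≟ p
... | yes refl = sym fp≡fq
... | no _ with k ≟ q
...   | yes refl = fp≡fq
...   | no _ = refl

transpose-natural : ∀ {m n} (f : Fin m → Fin n) → (∀ {x y} → f x ≡ f y → x ≡ y) →
  ∀ p q k → transpose (f p) (f q) (f k) ≡ f (transpose p q k)
transpose-natural f f-inj p q k with k ≟ p
... | yes refl = transpose-atˡ (f k) (f q)
... | no k≢p with k ≟ q
...   | yes refl = transpose-atʳ (f p) (f k)
...   | no k≢q = transpose-elsewhere (k≢p ∘ f-inj) (k≢q ∘ f-inj)

transpose-involutive : ∀ {n} (p q k : Fin n) → transpose p q (transpose p q k) ≡ k
transpose-involutive p q k with k ≟ p
... | yes refl = transpose-atʳ k q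
... | no k≢p with k ≟ q
...   | yes refl = transpose-atˡ p k
...   | no k≢q = transpose-elsewhere k≢p k≢q

map-transpose-allFin : ∀ {n} (p q : Fin n) → map (transpose p q) (allFin n) ∼[ bag ] allFin n
map-transpose-allFin {n} p q = unique∧set⇒bag
  (map⁺ τ-injective (allFin⁺ n))
  (allFin⁺ n)
  (λ {k} → mk⇔ (λ _ → ∈-allFin k) (λ _ → ∈-image k))
  where
  τ : Fin n → Fin n
  τ = transpose p q
  τ-injective : ∀ {x y} → τ x ≡ τ y → x ≡ y
  τ-injective {x} {y} τx≡τy =
    trans (sym (transpose-involutive p q x)) (trans (cong τ τx≡τy) (transpose-involutive p q y))
  ∈-image : ∀ k → k ∈ map τ (allFin n)
  ∈-image k = subst (_∈ map τ (allFin n)) (transpose-involutive p q k) (∈-map⁺ τ (∈-allFin (τ k)))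

labelAt : ∀ {V} → Fin V → Fin V → CEnd → List CEnd
labelAt u v x = if does (u ≟ v) then [ x ] else []

module _ {V E} (G : Graph V E) (bond : Fin E → ℕ) (hat : Fin E → Bool) (v : Fin V) where

  tailLabel headLabel : Fin E → List CEnd
  tailLabel e = labelAt (proj₁ (G e)) v (bond e , hat e)
  headLabel e = labelAt (proj₂ (G e)) v (bond e , not (hat e))

  tailLabels headLabels : List CEnd
  tailLabels = concatMap tailLabel (allFin E)
  headLabels = concatMap headLabel (allFin E)

  private
    -- `endLabels` maps a function local to its definition over the edges; this names it.
    endLabels-local : Σ (Fin E → List CEnd) λ labels → endLabels G bond hat v ≡ concatMap labels (allFin E)
    endLabels-local = _ , refl

    endLabels-local-split : ∀ e → proj₁ endLabels-local e ≡ tailLabel e ++ headLabel e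
    endLabels-local-split e with does (proj₁ (G e) ≟ v) | does (proj₂ (G e) ≟ v)
    ... | true  | true  = refl
    ... | true  | false = refl
    ... | false | true  = refl
    ... | false | false = refl

  endLabels-↭ : endLabels G bond hat v ↭ tailLabels ++ headLabels
  endLabels-↭ = begin
    endLabels G bond hat v
      ≡⟨ proj₂ endLabels-local ⟩
    concatMap (proj₁ endLabels-local) (allFin E)
      ≡⟨ concatMap-cong endLabels-local-split (allFin E) ⟩
    concatMap (λ e → tailLabel e ++ headLabel e) (allFin E)
      ↭⟨ ∼bag⇒↭ (>>=-left-distributive (allFin E)) ⟩
    tailLabels ++ headLabels
      ∎
    where open PermutationReasoning

swapHeads : ∀ {V E} → Graph V E → Fin E → Fin E → Graph V E
swapHeads G p q e = proj₁ (G e) , proj₂ (G (transpose p q e))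

headLabels-swapHeads : ∀ {V E} (G : Graph V E) (bond : Fin E → ℕ) (hat : Fin E → Bool) (v : Fin V)
  {p q : Fin E} → bond p ≡ bond q → hat p ≡ hat q →
  headLabels (swapHeads G p q) bond hat v ↭ headLabels G bond hat v
headLabels-swapHeads {E = E} G bond hat v {p} {q} bp≡bq hp≡hq = begin
  headLabels (swapHeads G p q) bond hat v
    ≡⟨ concatMap-cong relabel (allFin E) ⟩
  concatMap (headLabel G bond hat v ∘ τ) (allFin E)
    ≡⟨ concatMap-map (headLabel G bond hat v) τ (allFin E) ⟨
  concatMap (headLabel G bond hat v) (map τ (allFin E))
    ↭⟨ ∼bag⇒↭ (>>=-cong (map-transpose-allFin p q) (λ _ → K-refl)) ⟩
  headLabels G bond hat v
    ∎
  where
  open PermutationReasoning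
  τ : Fin E → Fin E
  τ = transpose p q
  relabel : ∀ e → headLabel (swapHeads G p q) bond hat v e ≡ headLabel G bond hat v (τ e)
  relabel e = cong₂ (λ b h → labelAt (proj₂ (G (τ e))) v (b , not h))
    (sym (transpose-invariant bond bp≡bq e)) (sym (transpose-invariant hat hp≡hq e))

swapHeads-realization : ∀ {P V E} {G : Graph V E} (r : Realization P G) {p q : Fin E} →
  Realization.bond r p ≡ Realization.bond r q → Realization.hat r p ≡ Realization.hat r q →
  Realization P (swapHeads G p q)
swapHeads-realization {P} {G = G} r {p} {q} bp≡bq hp≡hq = record
  { tile = tile ; bond = bond ; hat = hat ; fits = fits′ }
  where
  open Realization r
  fits′ : ∀ v → endLabels (swapHeads G p q) bond hat v ↭ lookup P (tile v)
  fits′ v = begin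
    endLabels (swapHeads G p q) bond hat v
      ↭⟨ endLabels-↭ (swapHeads G p q) bond hat v ⟩
    tailLabels G bond hat v ++ headLabels (swapHeads G p q) bond hat v
      ↭⟨ ++⁺ˡ (tailLabels G bond hat v) (headLabels-swapHeads G bond hat v bp≡bq hp≡hq) ⟩
    tailLabels G bond hat v ++ headLabels G bond hat v
      ↭⟨ endLabels-↭ G bond hat v ⟨
    endLabels G bond hat v
      ↭⟨ fits v ⟩
    lookup P (tile v)
      ∎
    where open PermutationReasoning

SameSide : ∀ {V} → Fin V → (Fin V → Bool) → Fin V × Fin V → Set
SameSide v colour xy = proj₁ xy ≢ v → proj₂ xy ≢ v → colour (proj₁ xy) ≡ colour (proj₂ xy)

-- v is not a cut vertex when G − v is connected, i.e. when every 2-colouring of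
-- G − v that is constant along its edges is constant.
NoCutVertex : ∀ {V E} → Graph V E → Set
NoCutVertex {V} G = ∀ v (colour : Fin V → Bool) →
  (∀ e → SameSide v colour (G e)) → ∀ x y → SameSide v colour (x , y)

SameSide-swap : ∀ {V} {v : Fin V} {colour : Fin V → Bool} {x y : Fin V} →
  SameSide v colour (x , y) → SameSide v colour (y , x)
SameSide-swap same y≢v x≢v = sym (same x≢v y≢v)

NoCutVertex-transport : ∀ {V E V′ E′} {G : Graph V E} {H : Graph V′ E′} →
  Iso G H → NoCutVertex H → NoCutVertex G
NoCutVertex-transport {V} {E} {V′} {E′} {G} {H} iso noCut v colour sides x y =
  pull (noCut (φ v) (colour ∘ φ⁻¹) sides′ (φ x) (φ y))
  where
  open Iso iso
  φ : Fin V → Fin V′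
  φ = Inverse.to vmap
  φ⁻¹ : Fin V′ → Fin V
  φ⁻¹ = Inverse.from vmap
  ψ : Fin E → Fin E′
  ψ = Inverse.to emap
  ψ⁻¹ : Fin E′ → Fin E
  ψ⁻¹ = Inverse.from emap

  φ⁻¹∘φ : ∀ z → φ⁻¹ (φ z) ≡ z
  φ⁻¹∘φ = Inverse.strictlyInverseʳ vmap
  φ-injective : ∀ {z w} → φ z ≡ φ w → z ≡ w
  φ-injective {z} {w} φz≡φw = trans (sym (φ⁻¹∘φ z)) (trans (cong φ⁻¹ φz≡φw) (φ⁻¹∘φ w))

  push : ∀ {z w} → SameSide v colour (z , w) → SameSide (φ v) (colour ∘ φ⁻¹) (φ z , φ w)
  push {z} {w} same φz≢φv φw≢φv rewrite φ⁻¹∘φ z | φ⁻¹∘φ w = same (φz≢φv ∘ cong φ) (φw≢φv ∘ cong φ)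

  pull : ∀ {z w} → SameSide (φ v) (colour ∘ φ⁻¹) (φ z , φ w) → SameSide v colour (z , w)
  pull {z} {w} same z≢v w≢v = begin
    colour z             ≡⟨ cong colour (φ⁻¹∘φ z) ⟨
    colour (φ⁻¹ (φ z))   ≡⟨ same (z≢v ∘ φ-injective) (w≢v ∘ φ-injective) ⟩
    colour (φ⁻¹ (φ w))   ≡⟨ cong colour (φ⁻¹∘φ w) ⟩
    colour w             ∎
    where open ≡-Reasoning

  image : ∀ e → SameSide (φ v) (colour ∘ φ⁻¹) (H (ψ e))
  image e with preserves e
  ... | inj₁ eq rewrite eq = push (sides e)
  ... | inj₂ eq rewrite eq = push (SameSide-swap {colour = colour} (sides e))

  sides′ : ∀ e′ → SameSide (φ v) (colour ∘ φ⁻¹) (H e′)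
  sides′ e′ =
    subst (SameSide (φ v) (colour ∘ φ⁻¹) ∘ H) (Inverse.strictlyInverseˡ emap e′) (image (ψ⁻¹ e′))

wheel-rim : ∀ k (i : Fin k) → wheel k (i ↑ˡ k) ≡ (fsuc i , fsuc (cyc i))
wheel-rim k i rewrite splitAt-↑ˡ k i k = refl

wheel-spoke : ∀ k (i : Fin k) → wheel k (k ↑ʳ i) ≡ (fzero , fsuc i)
wheel-spoke k i rewrite splitAt-↑ʳ k k i = refl

toℕ-cyc : ∀ {k} (i : Fin k) → suc (toℕ i) < k → toℕ (cyc i) ≡ suc (toℕ i)
toℕ-cyc {suc _} i 1+i<k = trans (toℕ-fromℕ< _) (m<n⇒m%n≡m 1+i<k)

toℕ-cyc-last : ∀ {k} (i : Fin k) → suc (toℕ i) ≡ k → toℕ (cyc i) ≡ 0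
toℕ-cyc-last {suc k} i 1+i≡k = trans (toℕ-fromℕ< _) (trans (cong (_% suc k) 1+i≡k) (n%n≡0 (suc k)))

cyc-inject₁ : ∀ {k} (i : Fin k) → cyc (inject₁ i) ≡ fsuc i
cyc-inject₁ {k} i = toℕ-injective (begin
  toℕ (cyc (inject₁ i))   ≡⟨ toℕ-cyc (inject₁ i) 1+i<1+k ⟩
  suc (toℕ (inject₁ i))   ≡⟨ cong suc (toℕ-inject₁ i) ⟩
  suc (toℕ i)             ∎)
  where
  open ≡-Reasoning
  1+i<1+k : suc (toℕ (inject₁ i)) < suc k
  1+i<1+k = s≤s (subst (_< k) (sym (toℕ-inject₁ i)) (toℕ<n i))

wheel-noCutVertex : ∀ k → NoCutVertex (wheel k)
wheel-noCutVertex k fzero colour sides fzero _ 0≢0 _ = contradiction refl 0≢0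
wheel-noCutVertex k fzero colour sides (fsuc _) fzero _ 0≢0 = contradiction refl 0≢0
wheel-noCutVertex (suc k) fzero colour sides (fsuc x) (fsuc y) _ _ = trans (rim-constant x) (sym (rim-constant y))
  where
  rim-edge : ∀ i → colour (fsuc i) ≡ colour (fsuc (cyc i))
  rim-edge i = subst (SameSide fzero colour) (wheel-rim (suc k) i) (sides (i ↑ˡ suc k)) (λ ()) (λ ())
  rim-step : ∀ i → colour (fsuc (inject₁ i)) ≡ colour (fsuc fzero) →
    colour (fsuc (fsuc i)) ≡ colour (fsuc fzero)
  rim-step i ih = trans (cong (colour ∘ fsuc) (sym (cyc-inject₁ i))) (trans (sym (rim-edge (inject₁ i))) ih)
  rim-constant : ∀ i → colour (fsuc i) ≡ colour (fsuc fzero)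
  rim-constant = <-weakInduction (λ i → colour (fsuc i) ≡ colour (fsuc fzero)) refl rim-step
wheel-noCutVertex k (fsuc h) colour sides x y x≢v y≢v = trans (hub-side x x≢v) (sym (hub-side y y≢v))
  where
  hub-side : ∀ z → z ≢ fsuc h → colour z ≡ colour fzero
  hub-side fzero _ = refl
  hub-side (fsuc z) z≢v =
    sym (subst (SameSide (fsuc h) colour) (wheel-spoke k z) (sides (k ↑ʳ z)) (λ ()) z≢v)

between : ℕ → ℕ → ℕ → Bool
between l u t = does (l <? t) ∧ does (t ≤? u)

module _ (l u : ℕ) where

  between-below : ∀ {t} → t ≤ l → between l u t ≡ false
  between-below {t} t≤l rewrite dec-false (l <? t) (≤⇒≯ t≤l) = refl

  between-inside : ∀ {t} → l < t → t ≤ u → between l u t ≡ true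
  between-inside {t} l<t t≤u rewrite dec-true (l <? t) l<t | dec-true (t ≤? u) t≤u = refl

  between-above : ∀ {t} → u < t → between l u t ≡ false
  between-above {t} u<t rewrite dec-false (t ≤? u) (<⇒≱ u<t) = ∧-zeroʳ _

  between-suc : ∀ {t} → t ≢ l → t ≢ u → between l u (suc t) ≡ between l u t
  between-suc {t} t≢l t≢u with <-cmp t l
  ... | tri< t<l _ _ = trans (between-below t<l) (sym (between-below (<⇒≤ t<l)))
  ... | tri≈ _ t≡l _ = contradiction t≡l t≢l
  ... | tri> _ _ l<t with <-cmp t u
  ...   | tri< t<u _ _ =
    trans (between-inside (<-trans l<t (n<1+n t)) t<u) (sym (between-inside l<t (<⇒≤ t<u)))
  ...   | tri≈ _ t≡u _ = contradiction t≡u t≢u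
  ...   | tri> _ _ u<t = trans (between-above (<-trans u<t (n<1+n t))) (sym (between-above u<t))

  between-cyc : ∀ {k} (m : Fin k) → u < k → toℕ m ≢ l → toℕ m ≢ u →
    between l u (toℕ (cyc m)) ≡ between l u (toℕ m)
  between-cyc m u<k m≢l m≢u with m≤n⇒m<n∨m≡n (toℕ<n m)
  ... | inj₁ 1+m<k rewrite toℕ-cyc m 1+m<k = between-suc m≢l m≢u
  ... | inj₂ 1+m≡k rewrite toℕ-cyc-last m 1+m≡k =
    trans (between-below z≤n) (sym (between-above (≤∧≢⇒< u≤m (m≢u ∘ sym))))
    where
    u≤m : u ≤ toℕ m
    u≤m = m<1+n⇒m≤n (subst (u <_) (sym 1+m≡k) u<k)

between-cyc-upper : ∀ {k} l (j : Fin k) → between l (toℕ j) (toℕ (cyc j)) ≡ false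
between-cyc-upper l j with m≤n⇒m<n∨m≡n (toℕ<n j)
... | inj₁ 1+j<k rewrite toℕ-cyc j 1+j<k = between-above l (toℕ j) (n<1+n _)
... | inj₂ 1+j≡k rewrite toℕ-cyc-last j 1+j≡k = between-below l (toℕ j) z≤n

between-cyc-lower : ∀ {k} {i j : Fin k} → toℕ i < toℕ j → between (toℕ i) (toℕ j) (toℕ (cyc i)) ≡ true
between-cyc-lower {i = i} {j} i<j rewrite toℕ-cyc i (≤-<-trans i<j (toℕ<n j)) =
  between-inside (toℕ i) (toℕ j) (n<1+n _) i<j

between-cyc-transpose : ∀ {k} {i j : Fin k} → toℕ i < toℕ j → ∀ m →
  between (toℕ i) (toℕ j) (toℕ (cyc (transpose i j m))) ≡ between (toℕ i) (toℕ j) (toℕ m)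
between-cyc-transpose {i = i} {j} i<j m with m ≟ i
... | yes refl = trans (between-cyc-upper (toℕ i) j) (sym (between-below (toℕ i) (toℕ j) ≤-refl))
... | no m≢i with m ≟ j
...   | yes refl = trans (between-cyc-lower i<j) (sym (between-inside (toℕ i) (toℕ j) i<j ≤-refl))
...   | no m≢j =
  between-cyc (toℕ i) (toℕ j) m (toℕ<n j) (m≢i ∘ toℕ-injective) (m≢j ∘ toℕ-injective)

swapHeads-wheel-rim : ∀ k (i j m : Fin k) →
  swapHeads (wheel k) (i ↑ˡ k) (j ↑ˡ k) (m ↑ˡ k) ≡ (fsuc m , fsuc (cyc (transpose i j m)))
swapHeads-wheel-rim k i j m = cong₂ _,_ (cong proj₁ (wheel-rim k m)) (begin
  proj₂ (wheel k (transpose (i ↑ˡ k) (j ↑ˡ k) (m ↑ˡ k)))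
    ≡⟨ cong (proj₂ ∘ wheel k) (transpose-natural (_↑ˡ k) (↑ˡ-injective k _ _) i j m) ⟩
  proj₂ (wheel k (transpose i j m ↑ˡ k))
    ≡⟨ cong proj₂ (wheel-rim k (transpose i j m)) ⟩
  fsuc (cyc (transpose i j m))
    ∎)
  where open ≡-Reasoning

swapHeads-wheel-cutVertex : ∀ {k} {i j : Fin k} → toℕ i < toℕ j →
  ¬ NoCutVertex (swapHeads (wheel k) (i ↑ˡ k) (j ↑ˡ k))
swapHeads-wheel-cutVertex {k} {i} {j} i<j noCut = contradiction false≡true λ ()
  where
  G : Graph (suc k) (k + k)
  G = swapHeads (wheel k) (i ↑ˡ k) (j ↑ˡ k)
  side : Fin (suc k) → Bool
  side fzero = false
  side (fsuc m) = between (toℕ i) (toℕ j) (toℕ m)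
  by-kind : ∀ s → SameSide fzero side (G (join k k s))
  by-kind (inj₁ m) = subst (SameSide fzero side) (sym (swapHeads-wheel-rim k i j m))
    λ _ _ → sym (between-cyc-transpose i<j m)
  by-kind (inj₂ m) hub≢hub _ = contradiction (cong proj₁ (wheel-spoke k m)) hub≢hub
  sides : ∀ e → SameSide fzero side (G e)
  sides e = subst (λ e → SameSide fzero side (G e)) (join-splitAt k k e) (by-kind (splitAt k e))
  false≡true : false ≡ true
  false≡true = begin
    false          ≡⟨ between-below (toℕ i) (toℕ j) ≤-refl ⟨
    side (fsuc i)  ≡⟨ noCut fzero side sides (fsuc i) (fsuc j) (λ ()) (λ ()) ⟩
    side (fsuc j)  ≡⟨ between-inside (toℕ i) (toℕ j) i<j ≤-refl ⟩
    true           ∎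
    where open ≡-Reasoning

swapHeads-wheel-noCutVertex : ∀ {P k} → CminIsWheel P k → (r : Realization P (wheel k)) → ∀ {p q} →
  Realization.bond r p ≡ Realization.bond r q → Realization.hat r p ≡ Realization.hat r q →
  NoCutVertex (swapHeads (wheel k) p q)
swapHeads-wheel-noCutVertex {k = k} cmin r bp≡bq hp≡hq =
  NoCutVertex-transport (CminIsWheel.unique cmin _ _ (swapHeads-realization r bp≡bq hp≡hq)) (wheel-noCutVertex k)

rim-label-injective : ∀ {P k} → CminIsWheel P k → (r : Realization P (wheel k)) → ∀ {i j : Fin k} →
  Realization.bond r (i ↑ˡ k) ≡ Realization.bond r (j ↑ˡ k) →
  Realization.hat r (i ↑ˡ k) ≡ Realization.hat r (j ↑ˡ k) → i ≡ j
rim-label-injective cmin r {i} {j} bi≡bj hi≡hj with <ᶠ-cmp i j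
... | tri< i<j _ _ =
  contradiction (swapHeads-wheel-noCutVertex cmin r bi≡bj hi≡hj) (swapHeads-wheel-cutVertex i<j)
... | tri≈ _ i≡j _ = i≡j
... | tri> _ _ j<i =
  contradiction (swapHeads-wheel-noCutVertex cmin r (sym bi≡bj) (sym hi≡hj)) (swapHeads-wheel-cutVertex j<i)

bool-collision : ∀ {A : Set} (f : A → Bool) {xs : List A} → Unique xs → 2 < length xs →
  ∃₂ λ x y → x ≢ y × x ∈ xs × y ∈ xs × f x ≡ f y
bool-collision f {[]} _ ()
bool-collision f {_ ∷ []} _ (s≤s ())
bool-collision f {_ ∷ _ ∷ []} _ (s≤s (s≤s ()))
bool-collision f {x ∷ y ∷ z ∷ _} ((x≢y ∷ x≢z ∷ _) ∷ (y≢z ∷ _) ∷ _) _ with f x ≟ᴮ f y | f x ≟ᴮ f z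
... | yes fx≡fy | _         = x , y , x≢y , here refl , there (here refl) , fx≡fy
... | no _      | yes fx≡fz = x , z , x≢z , here refl , there (there (here refl)) , fx≡fz
... | no fx≢fy  | no fx≢fz  = y , z , y≢z , there (here refl) , there (there (here refl)) ,
  trans (¬-not (fx≢fy ∘ sym)) (sym (¬-not (fx≢fz ∘ sym)))

lemma3 : (P : Pot) (k : ℕ) → 4 < suc k → CminIsWheel P k →
    (r : Realization P (wheel k)) (a : ℕ) → cycleUses r a ≤ 2
lemma3 P k _ cmin r a = ≮⇒≥ λ 2<uses →
  let x , y , x≢y , x∈uses , y∈uses , hx≡hy =
        bool-collision (λ i → hat (i ↑ˡ k)) (filter⁺ uses? (allFin⁺ k)) 2<uses
  in x≢y (rim-label-injective cmin r (trans (has-a x∈uses) (sym (has-a y∈uses))) hx≡hy)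
  where
  open Realization r
  uses? : (i : Fin k) → Dec (bond (i ↑ˡ k) ≡ a)
  uses? i = bond (i ↑ˡ k) ≟ℕ a
  has-a : ∀ {i} → i ∈ filter uses? (allFin k) → bond (i ↑ˡ k) ≡ a
  has-a = proj₂ ∘ ∈-filter⁻ uses? {xs = allFin k}
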